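{- For a symmetric monoidal category $\mathcal{V}$, let $\mathrm{Fam}(\mathcal{V}):\mathrm{Set}^{op}\to\mathrm{SMCat}$ send a set $S$ to the functor category $\mathcal{V}^S$ (with pointwise symmetric monoidal structure) and $f:S\to S'$ to precomposition $-\circ f:\mathcal{V}^{S'}\to\mathcal{V}^S$. Then $\mathrm{Fam}(\mathcal{V})$ admits a comprehension schema, $\mathrm{Fam}$ extends to a functor $\mathrm{SMCat}\to\mathrm{SMCat}^{\mathrm{Set}^{op}}_{\mathrm{compr}}$, and this functor is right adjoint to the forgetful functor $\mathrm{ev}_1:\mathrm{SMCat}^{\mathrm{Set}^{op}}_{\mathrm{compr}}\to\mathrm{SMCat}$ that evaluates at a one-element set (the empty context).
   Context: $\mathrm{SMCat}$ is the category of small symmetric monoidal categories and strong monoidal functors; $\mathrm{SMCat}^{\mathrm{Set}^{op}}$ is the category of functors $\mathrm{Set}^{op}\to\mathrm{SMCat}$ (strict indexed symmetric monoidal categories over $\mathrm{Set}$) and natural transformations, and $\mathrm{SMCat}^{\mathrm{Set}^{op}}_{\mathrm{compr}}$ is its full subcategory on those admitting a comprehension schema. For $\mathcal{L}:\mathcal{C}^{op}\to\mathrm{SMCat}$ with $\mathcal{C}$ having a terminal object, a comprehension schema consists of, for each $\Delta\in\mathcal{C}$ and $A\in\mathcal{L}(\Delta)$, a representation of the functor $(\mathcal{C}/\Delta)^{op}\to\mathrm{Set}$, $x\mapsto\mathcal{L}(\mathrm{dom}\,x)(I,\mathcal{L}(x)(A))$, i.e. an object $\mathbf{p}_{\Delta,A}:\Delta.A\to\Delta$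 of $\mathcal{C}/\Delta$ with a universal element $\mathbf{v}_{\Delta,A}\in\mathcal{L}(\Delta.A)(I,\mathcal{L}(\mathbf{p}_{\Delta,A})(A))$. -}

module Defs where

open import Level using (0ℓ)
open import Relation.Binary.PropositionalEquality
  using (_≡_; refl; sym; trans; cong; cong₂)
open import Data.Product using (Σ; Σ-syntax; _×_; _,_)
open import Data.Unit using (⊤)
open import Axiom.Extensionality.Propositional using (Extensionality)

record Category : Set₁ where
  infixr 9 _∘_
  field
    Obj : Set
    Hom : Obj → Obj → Set
    id  : ∀ {A} → Hom A A
    _∘_ : ∀ {A B C} → Hom B C → Hom A B → Hom A C
    identityˡ : ∀ {A B} {f : Hom A B} → id ∘ f ≡ f
    identityʳ : ∀ {A B} {f : Hom A B} → f ∘ id ≡ f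
    assoc : ∀ {A B C D} {f : Hom A B} {g : Hom B C} {h : Hom C D} →
            (h ∘ g) ∘ f ≡ h ∘ (g ∘ f)

idOf : (C : Category) → ∀ {x y} → x ≡ y → Category.Hom C x y
idOf C refl = Category.id C

record SMC : Set₁ where
  field
    cat : Category
  open Category cat public
  infixr 10 _⊗₀_ _⊗₁_
  field
    _⊗₀_ : Obj → Obj → Obj
    _⊗₁_ : ∀ {A B C D} → Hom A B → Hom C D → Hom (A ⊗₀ C) (B ⊗₀ D)
    ⊗-id : ∀ {A C} → id {A} ⊗₁ id {C} ≡ id
    ⊗-∘  : ∀ {A B C D E F} {f : Hom A B} {f' : Hom B C} {g : Hom D E} {g' : Hom E F} →
           (f' ∘ f) ⊗₁ (g' ∘ g) ≡ (f' ⊗₁ g') ∘ (f ⊗₁ g)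
    I : Obj
    α⇒ : ∀ {A B C} → Hom ((A ⊗₀ B) ⊗₀ C) (A ⊗₀ (B ⊗₀ C))
    α⇐ : ∀ {A B C} → Hom (A ⊗₀ (B ⊗₀ C)) ((A ⊗₀ B) ⊗₀ C)
    α-isoˡ : ∀ {A B C} → α⇐ {A} {B} {C} ∘ α⇒ ≡ id
    α-isoʳ : ∀ {A B C} → α⇒ {A} {B} {C} ∘ α⇐ ≡ id
    α-natural : ∀ {A A' B B' C C'} {f : Hom A A'} {g : Hom B B'} {h : Hom C C'} →
                α⇒ ∘ ((f ⊗₁ g) ⊗₁ h) ≡ (f ⊗₁ (g ⊗₁ h)) ∘ α⇒
    unitˡ⇒ : ∀ {A} → Hom (I ⊗₀ A) A
    unitˡ⇐ : ∀ {A} → Hom A (I ⊗₀ A)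
    unitˡ-isoˡ : ∀ {A} → unitˡ⇐ {A} ∘ unitˡ⇒ ≡ id
    unitˡ-isoʳ : ∀ {A} → unitˡ⇒ {A} ∘ unitˡ⇐ ≡ id
    unitˡ-natural : ∀ {A B} {f : Hom A B} → unitˡ⇒ ∘ (id {I} ⊗₁ f) ≡ f ∘ unitˡ⇒
    unitʳ⇒ : ∀ {A} → Hom (A ⊗₀ I) A
    unitʳ⇐ : ∀ {A} → Hom A (A ⊗₀ I)
    unitʳ-isoˡ : ∀ {A} → unitʳ⇐ {A} ∘ unitʳ⇒ ≡ id
    unitʳ-isoʳ : ∀ {A} → unitʳ⇒ {A} ∘ unitʳ⇐ ≡ id
    unitʳ-natural : ∀ {A B} {f : Hom A B} → unitʳ⇒ ∘ (f ⊗₁ id {I}) ≡ f ∘ unitʳ⇒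
    triangle : ∀ {A B} →
               (id {A} ⊗₁ unitˡ⇒ {B}) ∘ α⇒ {A} {I} {B} ≡ unitʳ⇒ {A} ⊗₁ id {B}
    pentagon : ∀ {A B C D} →
               (id {A} ⊗₁ α⇒ {B} {C} {D}) ∘ α⇒ {A} {B ⊗₀ C} {D} ∘ (α⇒ {A} {B} {C} ⊗₁ id {D})
               ≡ α⇒ {A} {B} {C ⊗₀ D} ∘ α⇒ {A ⊗₀ B} {C} {D}
    σ : ∀ {A B} → Hom (A ⊗₀ B) (B ⊗₀ A)
    σ-natural : ∀ {A A' B B'} {f : Hom A A'} {g : Hom B B'} →
                σ ∘ (f ⊗₁ g) ≡ (g ⊗₁ f) ∘ σ
    σ-involutive : ∀ {A B} → σ {B} {A} ∘ σ {A} {B} ≡ id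
    hexagon : ∀ {A B C} →
              α⇒ {B} {C} {A} ∘ σ {A} {B ⊗₀ C} ∘ α⇒ {A} {B} {C}
              ≡ (id {B} ⊗₁ σ {A} {C}) ∘ α⇒ {B} {A} {C} ∘ (σ {A} {B} ⊗₁ id {C})

module _ (V W : SMC) where
  private
    module V = SMC V
    module W = SMC W

  record SMFData : Set where
    field
      F₀ : V.Obj → W.Obj
      F₁ : ∀ {A B} → V.Hom A B → W.Hom (F₀ A) (F₀ B)
      φ  : ∀ {A B} → W.Hom (F₀ A W.⊗₀ F₀ B) (F₀ (A V.⊗₀ B))
      ε  : W.Hom W.I (F₀ V.I)

  record SMF : Set where
    field
      dat : SMFData
    open SMFData dat public
    field
      F-id : ∀ {A} → F₁ (V.id {A}) ≡ W.id
      F-∘  : ∀ {A B C} {f : V.Hom A B} {g : V.Hom B C} → F₁ (g V.∘ f) ≡ F₁ g W.∘ F₁ f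
      φ⁻¹ : ∀ {A B} → W.Hom (F₀ (A V.⊗₀ B)) (F₀ A W.⊗₀ F₀ B)
      φ-isoˡ : ∀ {A B} → φ⁻¹ {A} {B} W.∘ φ ≡ W.id
      φ-isoʳ : ∀ {A B} → φ {A} {B} W.∘ φ⁻¹ ≡ W.id
      φ-natural : ∀ {A A' B B'} {f : V.Hom A A'} {g : V.Hom B B'} →
                  F₁ (f V.⊗₁ g) W.∘ φ ≡ φ W.∘ (F₁ f W.⊗₁ F₁ g)
      ε⁻¹ : W.Hom (F₀ V.I) W.I
      ε-isoˡ : ε⁻¹ W.∘ ε ≡ W.id
      ε-isoʳ : ε W.∘ ε⁻¹ ≡ W.id
      φ-assoc : ∀ {A B C} →
                F₁ (V.α⇒ {A} {B} {C}) W.∘ φ W.∘ (φ W.⊗₁ W.id)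
                ≡ φ W.∘ (W.id W.⊗₁ φ) W.∘ W.α⇒
      φ-unitˡ : ∀ {A} → F₁ (V.unitˡ⇒ {A}) W.∘ φ W.∘ (ε W.⊗₁ W.id) ≡ W.unitˡ⇒
      φ-unitʳ : ∀ {A} → F₁ (V.unitʳ⇒ {A}) W.∘ φ W.∘ (W.id W.⊗₁ ε) ≡ W.unitʳ⇒

-- Equality of (strong monoidal) functors: strict equality, i.e. equal
-- object maps such that, transporting along these object equalities,
-- the morphism maps and the structure maps φ, ε agree.
module _ {V W : SMC} where
  private
    module V = SMC V
    module W = SMC W

  infix 4 _≐_
  record _≐_ (F G : SMFData V W) : Set where
    private
      module F = SMFData F
      module G = SMFData G
      ι : ∀ {x y} → x ≡ y → W.Hom x y
      ι = idOf W.cat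
    field
      eq₀ : ∀ x → F.F₀ x ≡ G.F₀ x
      eq₁ : ∀ {x y} (f : V.Hom x y) → ι (eq₀ y) W.∘ F.F₁ f ≡ G.F₁ f W.∘ ι (eq₀ x)
      eqφ : ∀ x y → ι (eq₀ (x V.⊗₀ y)) W.∘ F.φ {x} {y} ≡ G.φ W.∘ (ι (eq₀ x) W.⊗₁ ι (eq₀ y))
      eqε : ι (eq₀ V.I) W.∘ F.ε ≡ G.ε

idD : {V : SMC} → SMFData V V
idD {V} = record { F₀ = λ A → A ; F₁ = λ f → f ; φ = SMC.id V ; ε = SMC.id V }

compD : {U V W : SMC} → SMFData V W → SMFData U V → SMFData U W
compD {U} {V} {W} G F = record
  { F₀ = λ A → G.F₀ (F.F₀ A)
  ; F₁ = λ f → G.F₁ (F.F₁ f)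
  ; φ  = G.F₁ F.φ W.∘ G.φ
  ; ε  = G.F₁ F.ε W.∘ G.ε
  }
  where
    module G = SMFData G
    module F = SMFData F
    module W = SMC W

-- Strict indexed symmetric monoidal categories over Set
-- (functors Set^op → SMCat) and their morphisms (natural transformations)

record IndexedSMC : Set₁ where
  field
    obj : Set → SMC
    map : ∀ {S S' : Set} → (S → S') → SMF (obj S') (obj S)
    map-id : ∀ {S : Set} → SMF.dat (map (λ (s : S) → s)) ≐ idD
    map-∘  : ∀ {S S' S'' : Set} (f : S → S') (g : S' → S'') →
             SMF.dat (map (λ s → g (f s))) ≐ compD (SMF.dat (map f)) (SMF.dat (map g))

record IMor (L M : IndexedSMC) : Set₁ where
  private
    module L = IndexedSMC L
    module M = IndexedSMC M
  field
    η : ∀ (S : Set) → SMF (L.obj S) (M.obj S)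
    natural : ∀ {S S' : Set} (f : S → S') →
              compD (SMF.dat (η S)) (SMF.dat (L.map f)) ≐ compD (SMF.dat (M.map f)) (SMF.dat (η S'))

infix 4 _≐ᵀ_
_≐ᵀ_ : ∀ {L M} → IMor L M → IMor L M → Set₁
θ ≐ᵀ θ' = ∀ (S : Set) → SMF.dat (IMor.η θ S) ≐ SMF.dat (IMor.η θ' S)

ev₁ : IndexedSMC → SMC
ev₁ L = IndexedSMC.obj L ⊤

module _ (L : IndexedSMC) where
  open IndexedSMC L

  -- the functor (Set/Δ)^op → Set,  x ↦ L(dom x)(I, L(x)(A))
  Elt : ∀ {Γ Δ : Set} (x : Γ → Δ) (A : SMC.Obj (obj Δ)) → Set
  Elt {Γ} x A = SMC.Hom (obj Γ) (SMC.I (obj Γ)) (SMFData.F₀ (SMF.dat (map x)) A)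

  -- its action on a morphism  y : (Γ , x) → (Γ' , x')  of Set/Δ
  -- (q witnesses  x' ∘ y ≡ x)
  act : ∀ {Γ Γ' Δ : Set} (y : Γ → Γ') (x' : Γ' → Δ) (x : Γ → Δ)
        (q : (λ γ → x' (y γ)) ≡ x) {A : SMC.Obj (obj Δ)} →
        Elt x' A → Elt x A
  act {Γ} y x' x q {A} e =
    idOf C (cong (λ z → SMFData.F₀ (SMF.dat (map z)) A) q)
    ∘ idOf C (sym (_≐_.eq₀ (map-∘ y x') A))
    ∘ SMF.F₁ (map y) e
    ∘ SMF.ε (map y)
    where
      C = SMC.cat (obj Γ)
      open Category C using (_∘_)

  -- a representation of  x ↦ L(dom x)(I, L(x)(A)) : object p : Δ.A → Δ
  -- of Set/Δ with a universal element v
  record ComprehensionAt (Δ : Set) (A : SMC.Obj (obj Δ)) : Set₁ where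
    field
      ext : Set
      p   : ext → Δ
      v   : Elt p A
      universal : ∀ {Γ : Set} (x : Γ → Δ) (e : Elt x A) →
        Σ[ y ∈ (Γ → ext) ] Σ[ q ∈ (λ γ → p (y γ)) ≡ x ]
          (act y p x q v ≡ e
           × (∀ (y' : Γ → ext) (q' : (λ γ → p (y' γ)) ≡ x) → act y' p x q' v ≡ e → y' ≡ y))

  Comprehension : Set₁
  Comprehension = ∀ (Δ : Set) (A : SMC.Obj (obj Δ)) → ComprehensionAt Δ A

FunExt : Set₁
FunExt = Extensionality 0ℓ 0ℓ

module _ (fe : FunExt) (V : SMC) where
  private module V = SMC V

  Pointwise : Set → SMC
  Pointwise S = record
    { cat = record
      { Obj = S → V.Obj
      ; Hom = λ A B → (s : S) → V.Hom (A s) (B s)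
      ; id = λ s → V.id
      ; _∘_ = λ g f s → g s V.∘ f s
      ; identityˡ = fe λ s → V.identityˡ
      ; identityʳ = fe λ s → V.identityʳ
      ; assoc = fe λ s → V.assoc
      }
    ; _⊗₀_ = λ A B s → A s V.⊗₀ B s
    ; _⊗₁_ = λ f g s → f s V.⊗₁ g s
    ; ⊗-id = fe λ s → V.⊗-id
    ; ⊗-∘ = fe λ s → V.⊗-∘
    ; I = λ s → V.I
    ; α⇒ = λ s → V.α⇒
    ; α⇐ = λ s → V.α⇐
    ; α-isoˡ = fe λ s → V.α-isoˡ
    ; α-isoʳ = fe λ s → V.α-isoʳ
    ; α-natural = fe λ s → V.α-natural
    ; unitˡ⇒ = λ s → V.unitˡ⇒
    ; unitˡ⇐ = λ s → V.unitˡ⇐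
    ; unitˡ-isoˡ = fe λ s → V.unitˡ-isoˡ
    ; unitˡ-isoʳ = fe λ s → V.unitˡ-isoʳ
    ; unitˡ-natural = fe λ s → V.unitˡ-natural
    ; unitʳ⇒ = λ s → V.unitʳ⇒
    ; unitʳ⇐ = λ s → V.unitʳ⇐
    ; unitʳ-isoˡ = fe λ s → V.unitʳ-isoˡ
    ; unitʳ-isoʳ = fe λ s → V.unitʳ-isoʳ
    ; unitʳ-natural = fe λ s → V.unitʳ-natural
    ; triangle = fe λ s → V.triangle
    ; pentagon = fe λ s → V.pentagon
    ; σ = λ s → V.σ
    ; σ-natural = fe λ s → V.σ-natural
    ; σ-involutive = fe λ s → V.σ-involutive
    ; hexagon = fe λ s → V.hexagon
    }

  private
    lem₁ : ∀ {X Y Z} {f : V.Hom (X V.⊗₀ Y) Z} → f V.∘ (V.id V.∘ (V.id V.⊗₁ V.id)) ≡ f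
    lem₁ {f = f} = trans (cong (f V.∘_) (trans V.identityˡ V.⊗-id)) V.identityʳ
    lem₂ : ∀ {X Y Z} {f : V.Hom Z (X V.⊗₀ Y)} → V.id V.∘ ((V.id V.⊗₁ V.id) V.∘ f) ≡ f
    lem₂ {f = f} = trans V.identityˡ (trans (cong (V._∘ f) V.⊗-id) V.identityˡ)

    lem₃ : ∀ {X Y} → V.id {X V.⊗₀ Y} V.∘ V.id ≡ (V.id V.∘ V.id) V.∘ (V.id {X} V.⊗₁ V.id {Y})
    lem₃ = sym (trans (cong ((V.id V.∘ V.id) V.∘_) V.⊗-id) V.identityʳ)

  precomp : ∀ {S S' : Set} → (S → S') → SMF (Pointwise S') (Pointwise S)
  precomp f = record
    { dat = record
      { F₀ = λ A s → A (f s)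
      ; F₁ = λ h s → h (f s)
      ; φ = λ s → V.id
      ; ε = λ s → V.id
      }
    ; F-id = refl
    ; F-∘ = refl
    ; φ⁻¹ = λ s → V.id
    ; φ-isoˡ = fe λ s → V.identityˡ
    ; φ-isoʳ = fe λ s → V.identityˡ
    ; φ-natural = fe λ s → trans V.identityʳ (sym V.identityˡ)
    ; ε⁻¹ = λ s → V.id
    ; ε-isoˡ = fe λ s → V.identityˡ
    ; ε-isoʳ = fe λ s → V.identityˡ
    ; φ-assoc = fe λ s → trans lem₁ (sym lem₂)
    ; φ-unitˡ = fe λ s → lem₁
    ; φ-unitʳ = fe λ s → lem₁
    }

  private
    famφ : ∀ {S S' S'' : Set} (f : S → S') (g : S' → S'') (x y : S'' → V.Obj) →
           (λ (s : S) → V.id {x (g (f s)) V.⊗₀ y (g (f s))} V.∘ V.id)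
           ≡ (λ s → (V.id V.∘ V.id) V.∘ (V.id {x (g (f s))} V.⊗₁ V.id {y (g (f s))}))
    famφ f g x y = fe λ s → lem₃

    famε : ∀ {S S' S'' : Set} (f : S → S') (g : S' → S'') →
           (λ (s : S) → V.id {V.I} V.∘ V.id) ≡ (λ s → V.id V.∘ V.id)
    famε f g = refl

  Fam : IndexedSMC
  Fam = record
    { obj = Pointwise
    ; map = precomp
    ; map-id = λ {S} → record
      { eq₀ = λ x → refl
      ; eq₁ = λ f → trans (SMC.identityˡ (Pointwise S)) (sym (SMC.identityʳ (Pointwise S)))
      ; eqφ = λ x y → cong (SMC._∘_ (Pointwise S) (SMC.id (Pointwise S)))
                           (sym (SMC.⊗-id (Pointwise S)))
      ; eqε = SMC.identityˡ (Pointwise S)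
      }
    ; map-∘ = λ {S} f g → record
      { eq₀ = λ x → refl
      ; eq₁ = λ h → trans (SMC.identityˡ (Pointwise S)) (sym (SMC.identityʳ (Pointwise S)))
      ; eqφ = λ x y → famφ f g x y
      ; eqε = famε f g
      }
    }

-- "Fam extends to a functor SMCat → SMCat^{Set^op}_compr" for a given
-- action Fam₁ on morphisms.  (The compr-subcategory is full, so its
-- morphisms are the IMor's.)  Preservation of identities/composition is
-- stated for any strong monoidal functor equal to the identity/composite.

FamAction : FunExt → Set₁
FamAction fe = ∀ {V W : SMC} → SMF V W → IMor (Fam fe V) (Fam fe W)

record IsFunctor (fe : FunExt) (Fam₁ : FamAction fe) : Set₁ where
  field
    resp : ∀ {V W} {F G : SMF V W} → SMF.dat F ≐ SMF.dat G → Fam₁ F ≐ᵀ Fam₁ G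
    identity : ∀ {V} (H : SMF V V) → SMF.dat H ≐ idD →
               ∀ (S : Set) → SMF.dat (IMor.η (Fam₁ H) S) ≐ idD
    homomorphism : ∀ {U V W} (F : SMF U V) (G : SMF V W) (H : SMF U W) →
                   SMF.dat H ≐ compD (SMF.dat G) (SMF.dat F) →
                   ∀ (S : Set) → SMF.dat (IMor.η (Fam₁ H) S)
                                 ≐ compD (SMF.dat (IMor.η (Fam₁ G) S)) (SMF.dat (IMor.η (Fam₁ F) S))

-- ev₁ ⊣ Fam, as a bijection
--   SMCat(ev₁ L, V) ≅ SMCat^{Set^op}_compr(L, Fam V)
-- natural in L (ranging over indexed SMCs with a comprehension schema)
-- and in V.
record Ev₁⊣Fam (fe : FunExt) (Fam₁ : FamAction fe) : Set₂ where
  field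
    Φ : ∀ {L : IndexedSMC} → Comprehension L → ∀ {V : SMC} →
        SMF (ev₁ L) V → IMor L (Fam fe V)
    Ψ : ∀ {L : IndexedSMC} → Comprehension L → ∀ {V : SMC} →
        IMor L (Fam fe V) → SMF (ev₁ L) V
    Φ-resp : ∀ {L} (cL : Comprehension L) {V} {F G : SMF (ev₁ L) V} →
             SMF.dat F ≐ SMF.dat G → Φ {L} cL {V} F ≐ᵀ Φ {L} cL {V} G
    Ψ-resp : ∀ {L} (cL : Comprehension L) {V} {θ θ' : IMor L (Fam fe V)} →
             θ ≐ᵀ θ' → SMF.dat (Ψ {L} cL {V} θ) ≐ SMF.dat (Ψ {L} cL {V} θ')
    ΨΦ : ∀ {L} (cL : Comprehension L) {V} (F : SMF (ev₁ L) V) →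
         SMF.dat (Ψ {L} cL {V} (Φ {L} cL {V} F)) ≐ SMF.dat F
    ΦΨ : ∀ {L} (cL : Comprehension L) {V} (θ : IMor L (Fam fe V)) →
         Φ {L} cL {V} (Ψ {L} cL {V} θ) ≐ᵀ θ
    natural-V : ∀ {L} (cL : Comprehension L) {V W} (G : SMF V W)
                (F : SMF (ev₁ L) V) (H : SMF (ev₁ L) W) →
                SMF.dat H ≐ compD (SMF.dat G) (SMF.dat F) →
                ∀ (S : Set) → SMF.dat (IMor.η (Φ {L} cL {W} H) S)
                              ≐ compD (SMF.dat (IMor.η (Fam₁ {V} {W} G) S)) (SMF.dat (IMor.η (Φ {L} cL {V} F) S))
    natural-L : ∀ {L L'} (cL : Comprehension L) (cL' : Comprehension L') {V}
                (θ : IMor L' L) (F : SMF (ev₁ L) V) (H : SMF (ev₁ L') V) →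
                SMF.dat H ≐ compD (SMF.dat F) (SMF.dat (IMor.η θ ⊤)) →
                ∀ (S : Set) → SMF.dat (IMor.η (Φ {L'} cL' {V} H) S)
                              ≐ compD (SMF.dat (IMor.η (Φ {L} cL {V} F) S)) (SMF.dat (IMor.η θ S))

-- A strong monoidal functor F : L(1) → V determines, at each set S, the family
-- of functors F ∘ L(s) : L(S) → L(1) → V indexed by the points s : 1 → S, i.e.
-- a strong monoidal functor L(S) → V^S; naturality in S is the functoriality
-- of L.  Conversely a morphism θ : L → Fam(V) gives θ₁ : L(1) → V^1 = V, and
-- the two passages are inverse because θ_S is determined by its components
-- θ_S(−)(s) = θ₁ ∘ L(s) (naturality of θ along s : 1 → S).  Fam(V) has
-- comprehension because a global element of A ∈ V^Δ over x : Γ → Δ is just a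
-- family of global elements I → A(x γ), so Δ.A is the set of pairs (d , I → A d).
module Submission where

open import Defs
open import Data.Product using (Σ; Σ-syntax; _×_; _,_; proj₁; proj₂)
open import Data.Unit using (⊤; tt)
open import Function.Base using (const)
open import Relation.Binary.PropositionalEquality
  using (_≡_; refl; sym; trans; cong; cong₂; cong-app; module ≡-Reasoning)

-- The given extensionality is corrected to one that cong-app inverts, using
-- that the type of homotopies out of f is contractible.
module Extensionality (fe : FunExt) where
  private
    module _ {A : Set} {B : A → Set} (f : (x : A) → B x) where
      Homotopies : Set
      Homotopies = Σ ((x : A) → B x) λ g → ∀ x → f x ≡ g x

      centre : Homotopies
      centre = f , λ x → refl

      contraction : (h : Homotopies) → centre ≡ h
      contraction (g , h) = cong unzip (fe λ x → singleton x (g x , h x))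
        where
          singleton : ∀ x (p : Σ (B x) λ y → f x ≡ y) → (f x , refl) ≡ p
          singleton x (y , refl) = refl
          unzip : ((x : A) → Σ (B x) λ y → f x ≡ y) → Homotopies
          unzip k = (λ x → proj₁ (k x)) , (λ x → proj₂ (k x))

      cong-app-contraction : (h : Homotopies) (k : centre ≡ h) → cong-app (cong proj₁ k) ≡ proj₂ h
      cong-app-contraction h refl = refl

  ext : ∀ {A : Set} {B : A → Set} {f g : (x : A) → B x} → (∀ x → f x ≡ g x) → f ≡ g
  ext {f = f} {g} h = cong proj₁ (contraction f (g , h))

  cong-app-ext : ∀ {A : Set} {B : A → Set} {f g : (x : A) → B x} (h : ∀ x → f x ≡ g x) →
                 ∀ x → cong-app (ext h) x ≡ h x
  cong-app-ext {f = f} {g} h = cong-app (cong-app-contraction f (g , h) (contraction f (g , h)))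

module CategoryReasoning (C : Category) where
  open Category C

  pullˡ : ∀ {A B X Y} {a : Hom B Y} {b : Hom X B} {c : Hom X Y} {f : Hom A X} →
          a ∘ b ≡ c → a ∘ (b ∘ f) ≡ c ∘ f
  pullˡ h = trans (sym assoc) (cong (_∘ _) h)

  ∘-inverse : ∀ {A B C'} {a : Hom B A} {b : Hom C' B} {c : Hom B C'} {d : Hom A B} →
              b ∘ c ≡ id → a ∘ d ≡ id → (a ∘ b) ∘ (c ∘ d) ≡ id
  ∘-inverse bc ad = trans assoc (trans (cong (_ ∘_) (trans (pullˡ bc) identityˡ)) ad)

-- The shapes of the fields of _≐_: squares whose vertical sides are identities
-- transported along equalities of objects.
module Squares (W : SMC) where
  open SMC W

  ι : ∀ {x y} → x ≡ y → Hom x y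
  ι = idOf cat

  Square : ∀ {x x' y y'} → x ≡ x' → y ≡ y' → Hom x y → Hom x' y' → Set
  Square ex ey f g = ι ey ∘ f ≡ g ∘ ι ex

  Square⊗ : ∀ {a a' b b' c c'} → a ≡ a' → b ≡ b' → c ≡ c' →
            Hom (a ⊗₀ b) c → Hom (a' ⊗₀ b') c' → Set
  Square⊗ ea eb ec f g = ι ec ∘ f ≡ g ∘ (ι ea ⊗₁ ι eb)

  Triangle : ∀ {z y y'} → y ≡ y' → Hom z y → Hom z y' → Set
  Triangle e f g = ι e ∘ f ≡ g

  Square-refl : ∀ {x y} {f g : Hom x y} → f ≡ g → Square refl refl f g
  Square-refl refl = trans identityˡ (sym identityʳ)

  Square-refl⁻¹ : ∀ {x y} {f g : Hom x y} → Square refl refl f g → f ≡ g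
  Square-refl⁻¹ h = trans (sym identityˡ) (trans h identityʳ)

  Square⊗-refl : ∀ {a b c} {f g : Hom (a ⊗₀ b) c} → f ≡ g → Square⊗ refl refl refl f g
  Square⊗-refl refl = trans identityˡ (sym (trans (cong (_ ∘_) ⊗-id) identityʳ))

  Square⊗-refl⁻¹ : ∀ {a b c} {f g : Hom (a ⊗₀ b) c} → Square⊗ refl refl refl f g → f ≡ g
  Square⊗-refl⁻¹ h = trans (sym identityˡ) (trans h (trans (cong (_ ∘_) ⊗-id) identityʳ))

  Triangle-refl : ∀ {y z} {f g : Hom z y} → f ≡ g → Triangle refl f g
  Triangle-refl refl = identityˡ

  Triangle-refl⁻¹ : ∀ {y z} {f g : Hom z y} → Triangle refl f g → f ≡ g
  Triangle-refl⁻¹ h = trans (sym identityˡ) h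

  Square-sym : ∀ {a b c d} (ex : a ≡ b) (ey : c ≡ d) {f : Hom a c} {g : Hom b d} →
               Square ex ey f g → Square (sym ex) (sym ey) g f
  Square-sym refl refl h = Square-refl (sym (Square-refl⁻¹ h))

  Square⊗-sym : ∀ {a a' b b' c c'} (ea : a ≡ a') (eb : b ≡ b') (ec : c ≡ c')
                {f : Hom (a ⊗₀ b) c} {g : Hom (a' ⊗₀ b') c'} →
                Square⊗ ea eb ec f g → Square⊗ (sym ea) (sym eb) (sym ec) g f
  Square⊗-sym refl refl refl h = Square⊗-refl (sym (Square⊗-refl⁻¹ h))

  Triangle-sym : ∀ {a b c} (e : a ≡ b) {f : Hom c a} {g : Hom c b} →
                 Triangle e f g → Triangle (sym e) g f
  Triangle-sym refl h = Triangle-refl (sym (Triangle-refl⁻¹ h))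

  Square-trans : ∀ {a b c d e k} (ex : a ≡ b) (ex' : b ≡ c) (ey : d ≡ e) (ey' : e ≡ k)
                 {f : Hom a d} {g : Hom b e} {h : Hom c k} →
                 Square ex ey f g → Square ex' ey' g h → Square (trans ex ex') (trans ey ey') f h
  Square-trans refl refl refl refl p q = Square-refl (trans (Square-refl⁻¹ p) (Square-refl⁻¹ q))

  Square⊗-trans : ∀ {a a' a'' b b' b'' c c' c''} (ea : a ≡ a') (ea' : a' ≡ a'')
                  (eb : b ≡ b') (eb' : b' ≡ b'') (ec : c ≡ c') (ec' : c' ≡ c'')
                  {f : Hom (a ⊗₀ b) c} {g : Hom (a' ⊗₀ b') c'} {h : Hom (a'' ⊗₀ b'') c''} →
                  Square⊗ ea eb ec f g → Square⊗ ea' eb' ec' g h →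
                  Square⊗ (trans ea ea') (trans eb eb') (trans ec ec') f h
  Square⊗-trans refl refl refl refl refl refl p q =
    Square⊗-refl (trans (Square⊗-refl⁻¹ p) (Square⊗-refl⁻¹ q))

  Triangle-trans : ∀ {a b c d} (e : a ≡ b) (e' : b ≡ c) {f : Hom d a} {g : Hom d b} {h : Hom d c} →
                   Triangle e f g → Triangle e' g h → Triangle (trans e e') f h
  Triangle-trans refl refl p q = Triangle-refl (trans (Triangle-refl⁻¹ p) (Triangle-refl⁻¹ q))

  Square⊗-∘ : ∀ {a a' b b' c c' d d'} (e₁ : a ≡ a') (e₂ : b ≡ b') (e₃ : c ≡ c') (e₄ : d ≡ d')
              {p : Hom (a ⊗₀ b) c} {p' : Hom (a' ⊗₀ b') c'} {q : Hom c d} {q' : Hom c' d'} →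
              Square⊗ e₁ e₂ e₃ p p' → Square e₃ e₄ q q' → Square⊗ e₁ e₂ e₄ (q ∘ p) (q' ∘ p')
  Square⊗-∘ refl refl refl refl p q = Square⊗-refl (cong₂ _∘_ (Square-refl⁻¹ q) (Square⊗-refl⁻¹ p))

  Triangle-∘ : ∀ {a a' b b' c} (e₁ : a ≡ a') (e₂ : b ≡ b')
               {p : Hom c a} {p' : Hom c a'} {q : Hom a b} {q' : Hom a' b'} →
               Triangle e₁ p p' → Square e₁ e₂ q q' → Triangle e₂ (q ∘ p) (q' ∘ p')
  Triangle-∘ refl refl p q = Triangle-refl (cong₂ _∘_ (Square-refl⁻¹ q) (Triangle-refl⁻¹ p))

module SquaresImage {V W : SMC} (G : SMFData V W) where
  private
    module V = SMC V
    module W = SMC W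
    module V□ = Squares V
    module W□ = Squares W
  open SMFData G

  map-Square : ∀ {a b c d} (ex : a ≡ b) (ey : c ≡ d) {f : V.Hom a c} {g : V.Hom b d} →
               V□.Square ex ey f g → W□.Square (cong F₀ ex) (cong F₀ ey) (F₁ f) (F₁ g)
  map-Square refl refl h = W□.Square-refl (cong F₁ (V□.Square-refl⁻¹ h))

  map-Square⊗ : ∀ {a a' b b' c c'} (ea : a ≡ a') (eb : b ≡ b') (ec : c ≡ c')
                {f : V.Hom (a V.⊗₀ b) c} {g : V.Hom (a' V.⊗₀ b') c'} →
                V□.Square⊗ ea eb ec f g →
                W□.Square⊗ (cong F₀ ea) (cong F₀ eb) (cong F₀ ec) (F₁ f W.∘ φ) (F₁ g W.∘ φ)
  map-Square⊗ refl refl refl h = W□.Square⊗-refl (cong (λ z → F₁ z W.∘ φ) (V□.Square⊗-refl⁻¹ h))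

  map-Triangle : ∀ {a b} (e : a ≡ b) {f : V.Hom V.I a} {g : V.Hom V.I b} →
                 V□.Triangle e f g → W□.Triangle (cong F₀ e) (F₁ f W.∘ ε) (F₁ g W.∘ ε)
  map-Triangle refl h = W□.Triangle-refl (cong (λ z → F₁ z W.∘ ε) (V□.Triangle-refl⁻¹ h))

module _ {V W : SMC} where
  private
    module V = SMC V
    module W = SMC W
    open Squares W

  ≐-sym : {F G : SMFData V W} → F ≐ G → G ≐ F
  ≐-sym e = record
    { eq₀ = λ x → sym (eq₀ x)
    ; eq₁ = λ {x} {y} f → Square-sym (eq₀ x) (eq₀ y) (eq₁ f)
    ; eqφ = λ x y → Square⊗-sym (eq₀ x) (eq₀ y) (eq₀ (x V.⊗₀ y)) (eqφ x y)
    ; eqε = Triangle-sym (eq₀ V.I) eqε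
    }
    where open _≐_ e

  ≐-trans : {F G H : SMFData V W} → F ≐ G → G ≐ H → F ≐ H
  ≐-trans e e' = record
    { eq₀ = λ x → trans (E.eq₀ x) (E'.eq₀ x)
    ; eq₁ = λ {x} {y} f → Square-trans (E.eq₀ x) (E'.eq₀ x) (E.eq₀ y) (E'.eq₀ y) (E.eq₁ f) (E'.eq₁ f)
    ; eqφ = λ x y → Square⊗-trans (E.eq₀ x) (E'.eq₀ x) (E.eq₀ y) (E'.eq₀ y)
                      (E.eq₀ (x V.⊗₀ y)) (E'.eq₀ (x V.⊗₀ y)) (E.eqφ x y) (E'.eqφ x y)
    ; eqε = Triangle-trans (E.eq₀ V.I) (E'.eq₀ V.I) E.eqε E'.eqε
    }
    where
      module E = _≐_ e
      module E' = _≐_ e'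

  ≐-sameF₀ : {F₀ : V.Obj → W.Obj}
             {F₁ G₁ : ∀ {A B} → V.Hom A B → W.Hom (F₀ A) (F₀ B)}
             {φ ψ : ∀ {A B} → W.Hom (F₀ A W.⊗₀ F₀ B) (F₀ (A V.⊗₀ B))}
             {ε ε' : W.Hom W.I (F₀ V.I)} →
             (∀ {x y} (f : V.Hom x y) → F₁ f ≡ G₁ f) → (∀ x y → φ {x} {y} ≡ ψ) → ε ≡ ε' →
             _≐_ {V} {W} (record { F₀ = F₀ ; F₁ = F₁ ; φ = φ ; ε = ε })
                         (record { F₀ = F₀ ; F₁ = G₁ ; φ = ψ ; ε = ε' })
  ≐-sameF₀ F₁≡ φ≡ ε≡ = record
    { eq₀ = λ x → refl
    ; eq₁ = λ f → Square-refl (F₁≡ f)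
    ; eqφ = λ x y → Square⊗-refl (φ≡ x y)
    ; eqε = Triangle-refl ε≡
    }

module _ {U V W : SMC} where
  private
    module U = SMC U
    module V = SMC V
    module W = SMC W
    open Squares W

  compD-congˡ : {G G' : SMFData V W} (F : SMFData U V) → G ≐ G' → compD G F ≐ compD G' F
  compD-congˡ F e = record
    { eq₀ = λ x → eq₀ (F.F₀ x)
    ; eq₁ = λ f → eq₁ (F.F₁ f)
    ; eqφ = λ x y → Square⊗-∘ (eq₀ (F.F₀ x)) (eq₀ (F.F₀ y)) (eq₀ (F.F₀ x V.⊗₀ F.F₀ y))
                      (eq₀ (F.F₀ (x U.⊗₀ y))) (eqφ (F.F₀ x) (F.F₀ y)) (eq₁ F.φ)
    ; eqε = Triangle-∘ (eq₀ V.I) (eq₀ (F.F₀ U.I)) eqε (eq₁ F.ε)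
    }
    where
      open _≐_ e
      module F = SMFData F

  compD-congʳ : (G : SMFData V W) {F F' : SMFData U V} → F ≐ F' → compD G F ≐ compD G F'
  compD-congʳ G e = record
    { eq₀ = λ x → cong G.F₀ (eq₀ x)
    ; eq₁ = λ {x} {y} f → map-Square (eq₀ x) (eq₀ y) (eq₁ f)
    ; eqφ = λ x y → map-Square⊗ (eq₀ x) (eq₀ y) (eq₀ (x U.⊗₀ y)) (eqφ x y)
    ; eqε = map-Triangle (eq₀ U.I) eqε
    }
    where
      open _≐_ e
      module G = SMFData G
      open SquaresImage G

compD-assoc : {T U V W : SMC} (H : SMF V W) (G : SMFData U V) (F : SMFData T U) →
              compD (compD (SMF.dat H) G) F ≐ compD (SMF.dat H) (compD G F)
compD-assoc {W = W} H G F = ≐-sameF₀ (λ f → refl) (λ x y → pullˡ (sym (SMF.F-∘ H))) (pullˡ (sym (SMF.F-∘ H)))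
  where open CategoryReasoning (SMC.cat W)

compD-identityʳ : {V W : SMC} (F : SMF V W) → compD (SMF.dat F) idD ≐ SMF.dat F
compD-identityʳ {V} {W} F = ≐-sameF₀ (λ f → refl) (λ x y → F-id∘ φ) (F-id∘ ε)
  where
    open SMF F
    F-id∘ : ∀ {A B} (g : SMC.Hom W A (F₀ B)) → SMC._∘_ W (F₁ (SMC.id V)) g ≡ g
    F-id∘ g = trans (cong (λ z → SMC._∘_ W z g) F-id) (SMC.identityˡ W)

module Composite {U V W : SMC} (G : SMF V W) (F : SMF U V) where
  private
    module U = SMC U
    module V = SMC V
    module W = SMC W
    module G = SMF G
    module F = SMF F
    open CategoryReasoning W.cat
    open ≡-Reasoning

    ψ : ∀ {A B} → W.Hom (G.F₀ (F.F₀ A) W.⊗₀ G.F₀ (F.F₀ B)) (G.F₀ (F.F₀ (A U.⊗₀ B)))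
    ψ = G.F₁ F.φ W.∘ G.φ

    G-inverse : ∀ {a b} {f : V.Hom b a} {g : V.Hom a b} → f V.∘ g ≡ V.id → G.F₁ f W.∘ G.F₁ g ≡ W.id
    G-inverse h = trans (sym G.F-∘) (trans (cong G.F₁ h) G.F-id)

    id≡G-id∘id : ∀ {A} → W.id ≡ G.F₁ (V.id {A}) W.∘ W.id
    id≡G-id∘id = sym (trans W.identityʳ G.F-id)

    split-⊗idʳ : ∀ {A B C D} {f : V.Hom A B} {k : W.Hom C (G.F₀ A)} →
                 (G.F₁ f W.∘ k) W.⊗₁ W.id {G.F₀ D} ≡ (G.F₁ f W.⊗₁ G.F₁ V.id) W.∘ (k W.⊗₁ W.id)
    split-⊗idʳ {f = f} {k} = trans (cong ((G.F₁ f W.∘ k) W.⊗₁_) id≡G-id∘id) W.⊗-∘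

    split-⊗idˡ : ∀ {A B C D} {f : V.Hom A B} {k : W.Hom C (G.F₀ A)} →
                 W.id {G.F₀ D} W.⊗₁ (G.F₁ f W.∘ k) ≡ (G.F₁ V.id W.⊗₁ G.F₁ f) W.∘ (W.id W.⊗₁ k)
    split-⊗idˡ {f = f} {k} = trans (cong (W._⊗₁ (G.F₁ f W.∘ k)) id≡G-id∘id) W.⊗-∘

    absorb : ∀ {A A' B B'} {f : V.Hom A' (F.F₀ A)} {g : V.Hom B' (F.F₀ B)} →
             ψ {A} {B} W.∘ (G.F₁ f W.⊗₁ G.F₁ g) ≡ G.F₁ (F.φ V.∘ (f V.⊗₁ g)) W.∘ G.φ
    absorb {f = f} {g} = begin
      (G.F₁ F.φ W.∘ G.φ) W.∘ (G.F₁ f W.⊗₁ G.F₁ g) ≡⟨ W.assoc ⟩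
      G.F₁ F.φ W.∘ (G.φ W.∘ (G.F₁ f W.⊗₁ G.F₁ g)) ≡⟨ cong (G.F₁ F.φ W.∘_) (sym G.φ-natural) ⟩
      G.F₁ F.φ W.∘ (G.F₁ (f V.⊗₁ g) W.∘ G.φ)      ≡⟨ pullˡ (sym G.F-∘) ⟩
      G.F₁ (F.φ V.∘ (f V.⊗₁ g)) W.∘ G.φ            ∎

    absorb∘ : ∀ {A A' B B' X} {f : V.Hom A' (F.F₀ A)} {g : V.Hom B' (F.F₀ B)}
              {k : W.Hom X (G.F₀ A' W.⊗₀ G.F₀ B')} →
              ψ W.∘ ((G.F₁ f W.⊗₁ G.F₁ g) W.∘ k) ≡ G.F₁ (F.φ V.∘ (f V.⊗₁ g)) W.∘ (G.φ W.∘ k)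
    absorb∘ = trans (pullˡ absorb) W.assoc

    fuse : ∀ {A A' B B' X Y} {a : V.Hom (F.F₀ (A U.⊗₀ B)) Y}
           {f : V.Hom A' (F.F₀ A)} {g : V.Hom B' (F.F₀ B)}
           {k : W.Hom X (G.F₀ A' W.⊗₀ G.F₀ B')} →
           G.F₁ a W.∘ (ψ W.∘ ((G.F₁ f W.⊗₁ G.F₁ g) W.∘ k))
           ≡ G.F₁ (a V.∘ (F.φ V.∘ (f V.⊗₁ g))) W.∘ (G.φ W.∘ k)
    fuse {a = a} = trans (cong (G.F₁ a W.∘_) absorb∘) (pullˡ (sym G.F-∘))

    φ-natural : ∀ {A A' B B'} {f : U.Hom A A'} {g : U.Hom B B'} →
                G.F₁ (F.F₁ (f U.⊗₁ g)) W.∘ ψ ≡ ψ W.∘ (G.F₁ (F.F₁ f) W.⊗₁ G.F₁ (F.F₁ g))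
    φ-natural {f = f} {g} = begin
      G.F₁ (F.F₁ (f U.⊗₁ g)) W.∘ (G.F₁ F.φ W.∘ G.φ)  ≡⟨ pullˡ (sym G.F-∘) ⟩
      G.F₁ (F.F₁ (f U.⊗₁ g) V.∘ F.φ) W.∘ G.φ         ≡⟨ cong (λ z → G.F₁ z W.∘ G.φ) F.φ-natural ⟩
      G.F₁ (F.φ V.∘ (F.F₁ f V.⊗₁ F.F₁ g)) W.∘ G.φ    ≡⟨ sym absorb ⟩
      ψ W.∘ (G.F₁ (F.F₁ f) W.⊗₁ G.F₁ (F.F₁ g))        ∎

    φ-assoc : ∀ {A B C} →
              G.F₁ (F.F₁ (U.α⇒ {A} {B} {C})) W.∘ ψ W.∘ (ψ W.⊗₁ W.id) ≡ ψ W.∘ (W.id W.⊗₁ ψ) W.∘ W.α⇒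
    φ-assoc = begin
      G.F₁ (F.F₁ U.α⇒) W.∘ ψ W.∘ (ψ W.⊗₁ W.id)
        ≡⟨ cong (λ z → G.F₁ (F.F₁ U.α⇒) W.∘ ψ W.∘ z) split-⊗idʳ ⟩
      G.F₁ (F.F₁ U.α⇒) W.∘ ψ W.∘ (G.F₁ F.φ W.⊗₁ G.F₁ V.id) W.∘ (G.φ W.⊗₁ W.id)
        ≡⟨ fuse ⟩
      G.F₁ (F.F₁ U.α⇒ V.∘ F.φ V.∘ (F.φ V.⊗₁ V.id)) W.∘ G.φ W.∘ (G.φ W.⊗₁ W.id)
        ≡⟨ cong (λ z → G.F₁ z W.∘ G.φ W.∘ (G.φ W.⊗₁ W.id)) F.φ-assoc ⟩
      G.F₁ (F.φ V.∘ (V.id V.⊗₁ F.φ) V.∘ V.α⇒) W.∘ G.φ W.∘ (G.φ W.⊗₁ W.id)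
        ≡⟨ cong (W._∘ (G.φ W.∘ (G.φ W.⊗₁ W.id))) (trans (cong G.F₁ (sym V.assoc)) G.F-∘) ⟩
      (G.F₁ (F.φ V.∘ (V.id V.⊗₁ F.φ)) W.∘ G.F₁ V.α⇒) W.∘ G.φ W.∘ (G.φ W.⊗₁ W.id)
        ≡⟨ W.assoc ⟩
      G.F₁ (F.φ V.∘ (V.id V.⊗₁ F.φ)) W.∘ G.F₁ V.α⇒ W.∘ G.φ W.∘ (G.φ W.⊗₁ W.id)
        ≡⟨ cong (G.F₁ (F.φ V.∘ (V.id V.⊗₁ F.φ)) W.∘_) G.φ-assoc ⟩
      G.F₁ (F.φ V.∘ (V.id V.⊗₁ F.φ)) W.∘ G.φ W.∘ (W.id W.⊗₁ G.φ) W.∘ W.α⇒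
        ≡⟨ sym absorb∘ ⟩
      ψ W.∘ (G.F₁ V.id W.⊗₁ G.F₁ F.φ) W.∘ (W.id W.⊗₁ G.φ) W.∘ W.α⇒
        ≡⟨ cong (ψ W.∘_) (pullˡ (sym split-⊗idˡ)) ⟩
      ψ W.∘ (W.id W.⊗₁ ψ) W.∘ W.α⇒
        ∎

    φ-unitˡ : ∀ {A} → G.F₁ (F.F₁ (U.unitˡ⇒ {A})) W.∘ ψ W.∘ ((G.F₁ F.ε W.∘ G.ε) W.⊗₁ W.id) ≡ W.unitˡ⇒
    φ-unitˡ = begin
      G.F₁ (F.F₁ U.unitˡ⇒) W.∘ ψ W.∘ ((G.F₁ F.ε W.∘ G.ε) W.⊗₁ W.id)
        ≡⟨ cong (λ z → G.F₁ (F.F₁ U.unitˡ⇒) W.∘ ψ W.∘ z) split-⊗idʳ ⟩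
      G.F₁ (F.F₁ U.unitˡ⇒) W.∘ ψ W.∘ (G.F₁ F.ε W.⊗₁ G.F₁ V.id) W.∘ (G.ε W.⊗₁ W.id)
        ≡⟨ fuse ⟩
      G.F₁ (F.F₁ U.unitˡ⇒ V.∘ F.φ V.∘ (F.ε V.⊗₁ V.id)) W.∘ G.φ W.∘ (G.ε W.⊗₁ W.id)
        ≡⟨ cong (λ z → G.F₁ z W.∘ G.φ W.∘ (G.ε W.⊗₁ W.id)) F.φ-unitˡ ⟩
      G.F₁ V.unitˡ⇒ W.∘ G.φ W.∘ (G.ε W.⊗₁ W.id)
        ≡⟨ G.φ-unitˡ ⟩
      W.unitˡ⇒
        ∎

    φ-unitʳ : ∀ {A} → G.F₁ (F.F₁ (U.unitʳ⇒ {A})) W.∘ ψ W.∘ (W.id W.⊗₁ (G.F₁ F.ε W.∘ G.ε)) ≡ W.unitʳ⇒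
    φ-unitʳ = begin
      G.F₁ (F.F₁ U.unitʳ⇒) W.∘ ψ W.∘ (W.id W.⊗₁ (G.F₁ F.ε W.∘ G.ε))
        ≡⟨ cong (λ z → G.F₁ (F.F₁ U.unitʳ⇒) W.∘ ψ W.∘ z) split-⊗idˡ ⟩
      G.F₁ (F.F₁ U.unitʳ⇒) W.∘ ψ W.∘ (G.F₁ V.id W.⊗₁ G.F₁ F.ε) W.∘ (W.id W.⊗₁ G.ε)
        ≡⟨ fuse ⟩
      G.F₁ (F.F₁ U.unitʳ⇒ V.∘ F.φ V.∘ (V.id V.⊗₁ F.ε)) W.∘ G.φ W.∘ (W.id W.⊗₁ G.ε)
        ≡⟨ cong (λ z → G.F₁ z W.∘ G.φ W.∘ (W.id W.⊗₁ G.ε)) F.φ-unitʳ ⟩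
      G.F₁ V.unitʳ⇒ W.∘ G.φ W.∘ (W.id W.⊗₁ G.ε)
        ≡⟨ G.φ-unitʳ ⟩
      W.unitʳ⇒
        ∎

  _∘SMF_ : SMF U W
  _∘SMF_ = record
    { dat = compD G.dat F.dat
    ; F-id = trans (cong G.F₁ F.F-id) G.F-id
    ; F-∘ = trans (cong G.F₁ F.F-∘) G.F-∘
    ; φ⁻¹ = G.φ⁻¹ W.∘ G.F₁ F.φ⁻¹
    ; φ-isoˡ = ∘-inverse (G-inverse F.φ-isoˡ) G.φ-isoˡ
    ; φ-isoʳ = ∘-inverse G.φ-isoʳ (G-inverse F.φ-isoʳ)
    ; φ-natural = φ-natural
    ; ε⁻¹ = G.ε⁻¹ W.∘ G.F₁ F.ε⁻¹
    ; ε-isoˡ = ∘-inverse (G-inverse F.ε-isoˡ) G.ε-isoˡ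
    ; ε-isoʳ = ∘-inverse G.ε-isoʳ (G-inverse F.ε-isoʳ)
    ; φ-assoc = φ-assoc
    ; φ-unitˡ = φ-unitˡ
    ; φ-unitʳ = φ-unitʳ
    }

open Composite using (_∘SMF_)

module FamConstructions (fe : FunExt) where
  open Extensionality fe

  module _ {X V : SMC} {S : Set} where
    private
      module X = SMC X
      module V = SMC V
      P = Pointwise fe V S
      module P = SMC P

    component : SMFData X P → S → SMFData X V
    component F s = record { F₀ = λ A → F.F₀ A s ; F₁ = λ f → F.F₁ f s ; φ = F.φ s ; ε = F.ε s }
      where module F = SMFData F

    idOf-Pointwise : {A B : S → V.Obj} (p : A ≡ B) → idOf P.cat p ≡ λ s → idOf V.cat (cong-app p s)
    idOf-Pointwise refl = refl

    idOf-Pointwise-ext : {A B : S → V.Obj} (h : ∀ s → A s ≡ B s) →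
                         idOf P.cat (ext h) ≡ λ s → idOf V.cat (h s)
    idOf-Pointwise-ext h = trans (idOf-Pointwise (ext h)) (fe λ s → cong (idOf V.cat) (cong-app-ext h s))

    ≐-pointwise : {F G : SMFData X P} → (∀ s → component F s ≐ component G s) → F ≐ G
    ≐-pointwise {F} {G} e = record
      { eq₀ = λ x → ext (λ s → E.eq₀ s x)
      ; eq₁ = λ {x} {y} f →
          trans (cong (P._∘ F.F₁ f) (ι≡ y))
                (trans (fe λ s → E.eq₁ s f) (cong (G.F₁ f P.∘_) (sym (ι≡ x))))
      ; eqφ = λ x y →
          trans (cong (P._∘ F.φ) (ι≡ (x X.⊗₀ y)))
                (trans (fe λ s → E.eqφ s x y) (cong (G.φ P.∘_) (sym (cong₂ P._⊗₁_ (ι≡ x) (ι≡ y)))))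
      ; eqε = trans (cong (P._∘ F.ε) (ι≡ X.I)) (fe λ s → E.eqε s)
      }
      where
        module E s = _≐_ (e s)
        module F = SMFData F
        module G = SMFData G
        ι≡ : ∀ x → idOf P.cat (ext (λ s → E.eq₀ s x)) ≡ λ s → idOf V.cat (E.eq₀ s x)
        ι≡ x = idOf-Pointwise-ext (λ s → E.eq₀ s x)

  tuple : {X V : SMC} {S : Set} → (S → SMF X V) → SMF X (Pointwise fe V S)
  tuple D = record
    { dat = record { F₀ = λ A s → D.F₀ s A ; F₁ = λ h s → D.F₁ s h ; φ = λ s → D.φ s ; ε = λ s → D.ε s }
    ; F-id = fe λ s → D.F-id s
    ; F-∘ = fe λ s → D.F-∘ s
    ; φ⁻¹ = λ s → D.φ⁻¹ s
    ; φ-isoˡ = fe λ s → D.φ-isoˡ s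
    ; φ-isoʳ = fe λ s → D.φ-isoʳ s
    ; φ-natural = fe λ s → D.φ-natural s
    ; ε⁻¹ = λ s → D.ε⁻¹ s
    ; ε-isoˡ = fe λ s → D.ε-isoˡ s
    ; ε-isoʳ = fe λ s → D.ε-isoʳ s
    ; φ-assoc = fe λ s → D.φ-assoc s
    ; φ-unitˡ = fe λ s → D.φ-unitˡ s
    ; φ-unitʳ = fe λ s → D.φ-unitʳ s
    }
    where module D s = SMF (D s)

  evaluate : {V : SMC} {S : Set} → S → SMF (Pointwise fe V S) V
  evaluate {V} s = record
    { dat = record { F₀ = λ A → A s ; F₁ = λ h → h s ; φ = V.id ; ε = V.id }
    ; F-id = refl
    ; F-∘ = refl
    ; φ⁻¹ = V.id
    ; φ-isoˡ = V.identityˡ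
    ; φ-isoʳ = V.identityˡ
    ; φ-natural = trans V.identityʳ (sym V.identityˡ)
    ; ε⁻¹ = V.id
    ; ε-isoˡ = V.identityˡ
    ; ε-isoʳ = V.identityˡ
    ; φ-assoc = trans (cong (V.α⇒ V.∘_) id∘id⊗id) (trans V.identityʳ (sym (trans V.identityˡ (id⊗id∘α))))
    ; φ-unitˡ = trans (cong (V.unitˡ⇒ V.∘_) id∘id⊗id) V.identityʳ
    ; φ-unitʳ = trans (cong (V.unitʳ⇒ V.∘_) id∘id⊗id) V.identityʳ
    }
    where
      module V = SMC V
      id∘id⊗id : ∀ {A B} → V.id V.∘ (V.id V.⊗₁ V.id) ≡ V.id {A V.⊗₀ B}
      id∘id⊗id = trans V.identityˡ V.⊗-id
      id⊗id∘α : ∀ {A B C} → (V.id V.⊗₁ V.id) V.∘ V.α⇒ ≡ V.α⇒ {A} {B} {C}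
      id⊗id∘α = trans (cong (V._∘ V.α⇒) V.⊗-id) V.identityˡ

  pointwiseD : {V W : SMC} → SMFData V W → (S : Set) → SMFData (Pointwise fe V S) (Pointwise fe W S)
  pointwiseD G S = record { F₀ = λ A s → G.F₀ (A s) ; F₁ = λ h s → G.F₁ (h s) ; φ = λ s → G.φ ; ε = λ s → G.ε }
    where module G = SMFData G

  pointwise-cong : {V W : SMC} {F G : SMFData V W} (S : Set) → F ≐ G → pointwiseD F S ≐ pointwiseD G S
  pointwise-cong {V} {W} S e = ≐-pointwise {Pointwise fe V S} {W} {S} λ s → record
    { eq₀ = λ x → eq₀ (x s) ; eq₁ = λ f → eq₁ (f s) ; eqφ = λ x y → eqφ (x s) (y s) ; eqε = eqε }
    where open _≐_ e

  postcompose : {V W : SMC} (G : SMF V W) (S : Set) → SMF (Pointwise fe V S) (Pointwise fe W S)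
  postcompose G S = record
    { dat = pointwiseD G.dat S
    ; F-id = fe λ s → G.F-id
    ; F-∘ = fe λ s → G.F-∘
    ; φ⁻¹ = λ s → G.φ⁻¹
    ; φ-isoˡ = fe λ s → G.φ-isoˡ
    ; φ-isoʳ = fe λ s → G.φ-isoʳ
    ; φ-natural = fe λ s → G.φ-natural
    ; ε⁻¹ = λ s → G.ε⁻¹
    ; ε-isoˡ = fe λ s → G.ε-isoˡ
    ; ε-isoʳ = fe λ s → G.ε-isoʳ
    ; φ-assoc = fe λ s → G.φ-assoc
    ; φ-unitˡ = fe λ s → G.φ-unitˡ
    ; φ-unitʳ = fe λ s → G.φ-unitʳ
    }
    where module G = SMF G

  Fam₁ : FamAction fe
  Fam₁ {V} {W} G = record
    { η = postcompose G
    ; natural = λ f → ≐-sameF₀ (λ h → refl) (λ x y → fe λ s → F-id∘≡∘id G.φ) (fe λ s → F-id∘≡∘id G.ε)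
    }
    where
      module G = SMF G
      module W = SMC W
      F-id∘≡∘id : ∀ {A B} (g : W.Hom A (G.F₀ B)) → G.F₁ (SMC.id V) W.∘ g ≡ g W.∘ W.id
      F-id∘≡∘id g = trans (cong (W._∘ g) G.F-id) (trans W.identityˡ (sym W.identityʳ))

  Fam₁-isFunctor : IsFunctor fe Fam₁
  Fam₁-isFunctor = record
    { resp = λ e S → pointwise-cong S e
    ; identity = λ H e S → pointwise-cong S e
    ; homomorphism = λ F G H e S → pointwise-cong S e
    }

  Fam-comprehension : (V : SMC) → Comprehension (Fam fe V)
  Fam-comprehension V Δ A = record
    { ext = Σ Δ λ d → V.Hom V.I (A d)
    ; p = proj₁
    ; v = proj₂
    ; universal = λ x e → (λ γ → x γ , e γ) , refl , fe (λ γ → identities-cancel) , unique x e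
    }
    where
      module V = SMC V
      identities-cancel : ∀ {X Y} {f : V.Hom X Y} → V.id V.∘ (V.id V.∘ (f V.∘ V.id)) ≡ f
      identities-cancel = trans V.identityˡ (trans V.identityˡ V.identityʳ)
      unique : ∀ {Γ : Set} (x : Γ → Δ) (e : (γ : Γ) → V.Hom V.I (A (x γ)))
               (y : Γ → Σ Δ λ d → V.Hom V.I (A d)) (q : (λ γ → proj₁ (y γ)) ≡ x) →
               act (Fam fe V) y proj₁ x q {A} proj₂ ≡ e → y ≡ (λ γ → x γ , e γ)
      unique x e y refl refl = fe λ γ → cong (proj₁ (y γ) ,_) (sym identities-cancel)

  point : (L : IndexedSMC) {S : Set} → S → SMFData (IndexedSMC.obj L S) (ev₁ L)
  point L s = SMF.dat (IndexedSMC.map L (const s))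

  module _ {L : IndexedSMC} {V : SMC} where
    private
      module L = IndexedSMC L
      module V = SMC V

    transpose : SMF (ev₁ L) V → IMor L (Fam fe V)
    transpose F = record
      { η = λ S → tuple (λ s → F ∘SMF L.map (const s))
      ; natural = λ {S} {S'} f → ≐-pointwise {L.obj S'} {V} {S} λ s →
          ≐-trans (compD-assoc F (point L s) (SMF.dat (L.map f)))
          (≐-trans (compD-congʳ (SMF.dat F) (≐-sym (L.map-∘ (const s) f)))
            (≐-sameF₀ (λ h → refl) (λ x y → sym V.identityʳ) (sym V.identityʳ)))
      }

    transpose⁻¹ : IMor L (Fam fe V) → SMF (ev₁ L) V
    transpose⁻¹ θ = evaluate tt ∘SMF IMor.η θ ⊤

  -- The bijection exists for every indexed category; comprehension is only
  -- the condition cutting out the full subcategory.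
  ev₁⊣Fam : Ev₁⊣Fam fe Fam₁
  ev₁⊣Fam = record
    { Φ = λ _ → transpose
    ; Ψ = λ _ → transpose⁻¹
    ; Φ-resp = λ {L} _ {V} e S → ≐-pointwise {IndexedSMC.obj L S} {V} {S} λ s →
        compD-congˡ (point L s) e
    ; Ψ-resp = λ _ {V} e → compD-congʳ (SMF.dat (evaluate {V} tt)) (e ⊤)
    ; ΨΦ = λ {L} _ {V} F →
        ≐-trans (≐-sameF₀ (λ h → refl) (λ x y → SMC.identityʳ V) (SMC.identityʳ V))
        (≐-trans (compD-congʳ (SMF.dat F) (IndexedSMC.map-id L)) (compD-identityʳ F))
    ; ΦΨ = λ {L} _ {V} θ S → ≐-pointwise {IndexedSMC.obj L S} {V} {S} λ s →
        ≐-trans (compD-assoc (evaluate tt) (SMF.dat (IMor.η θ ⊤)) (point L s))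
        (≐-trans (compD-congʳ (SMF.dat (evaluate {V} tt)) (IMor.natural θ (const s)))
          (≐-sameF₀ (λ h → refl) (λ x y → ∘id∘id V) (∘id∘id V)))
    ; natural-V = λ {L} _ {V} {W} G F H e S → ≐-pointwise {IndexedSMC.obj L S} {W} {S} λ s →
        ≐-trans (compD-congˡ (point L s) e)
          (compD-assoc G (SMF.dat F) (point L s))
    ; natural-L = λ {L} {L'} _ _ {V} θ F H e S → ≐-pointwise {IndexedSMC.obj L' S} {V} {S} λ s →
        ≐-trans (compD-congˡ (point L' s) e)
        (≐-trans (compD-assoc F (SMF.dat (IMor.η θ ⊤)) (point L' s))
        (≐-trans (compD-congʳ (SMF.dat F) (IMor.natural θ (const s)))
          (≐-sym (compD-assoc F (point L s) (SMF.dat (IMor.η θ S))))))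
    }
    where
      ∘id∘id : (V : SMC) → ∀ {X Y} {f : SMC.Hom V X Y} → SMC._∘_ V (SMC._∘_ V f (SMC.id V)) (SMC.id V) ≡ f
      ∘id∘id V = trans (SMC.identityʳ V) (SMC.identityʳ V)

theorem11 : (fe : FunExt) →
    Σ[ compr ∈ (∀ (V : SMC) → Comprehension (Fam fe V)) ]
    Σ[ Fam₁ ∈ FamAction fe ]
    (IsFunctor fe Fam₁ × Ev₁⊣Fam fe Fam₁)
theorem11 fe = Fam-comprehension , Fam₁ , Fam₁-isFunctor , ev₁⊣Fam
  where open FamConstructions fe
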